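{- Let $\mathbb{K}=(G,M,I)$ be a formal context and $\mathbb{S}=(H,N,J)$ a closed-subcontext of $\mathbb{K}$. Then $H=G$ or there exists $m\in N$ with $m'=H$. And $N=M$ or there exists $g\in H$ with $g'=N$.
   Context: All sets are finite. A formal context $\mathbb{K}=(G,M,I)$ has finite $G$, $M$ and $I\subseteq G\times M$; for $m\in M$, $m'=\{g\in G\mid (g,m)\in I\}$ and for $g\in G$, $g'=\{m\in M\mid (g,m)\in I\}$; more generally $A'$, $B'$ for sets are the common attributes / common objects. A formal concept is $(A,B)$ with $A'=B$, $B'=A$. A formal context $\mathbb{S}=(H,N,J)$ is a closed-subcontext of $\mathbb{K}$ iff $H\subseteq G$, $N\subseteq M$, $J\subseteq I\cap(H\times N)$, and every formal concept of $\mathbb{S}$ (computed w.r.t. $J$) is a formal concept of $\mathbb{K}$. -}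

module Defs where

open import Data.Nat using (ℕ)
open import Data.Fin using (Fin)
open import Data.Fin.Subset using (Subset; _∈_; ⊤)
open import Data.Bool using (Bool; true)
open import Data.Product using (_×_)
open import Function.Bundles using (_⇔_)
open import Relation.Binary.PropositionalEquality using (_≡_)

-- A formal context K = (G, M, I) with G = Fin n, M = Fin k (arbitrary finite sets,
-- enumerated), and incidence I ⊆ G × M given by its (decidable) characteristic function:
-- (g , m) ∈ I  iff  I g m ≡ true.
Incidence : ℕ → ℕ → Set
Incidence n k = Fin n → Fin k → Bool

AttrDer : ∀ {n k} → Incidence n k → Subset k → Subset n → Fin k → Set
AttrDer R N A m = m ∈ N × (∀ g → g ∈ A → R g m ≡ true)

ObjDer : ∀ {n k} → Incidence n k → Subset n → Subset k → Fin n → Set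
ObjDer R H B g = g ∈ H × (∀ m → m ∈ B → R g m ≡ true)

IsConcept : ∀ {n k} → Subset n → Subset k → Incidence n k →
            Subset n → Subset k → Set
IsConcept H N R A B =
  (∀ m → (m ∈ B ⇔ AttrDer R N A m)) × (∀ g → (g ∈ A ⇔ ObjDer R H B g))

-- S = (H, N, J) is a closed-subcontext of K = (G, M, I) = (Fin n, Fin k, I):
-- H ⊆ G and N ⊆ M hold by typing; J ⊆ I ∩ (H × N); and every formal concept
-- of S (w.r.t. J) is a formal concept of K (w.r.t. I, with G and M full).
IsClosedSubcontext : ∀ {n k} → Incidence n k →
                     Subset n → Subset k → Incidence n k → Set
IsClosedSubcontext {n} {k} I H N J =
  (∀ g m → J g m ≡ true → (I g m ≡ true × g ∈ H × m ∈ N)) ×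
  (∀ (A : Subset n) (B : Subset k) → IsConcept H N J A B → IsConcept ⊤ ⊤ I A B)

-- H is the extent of the concept (H , H′) of S, so (H , H′) is also a concept of K.
-- If the intent H′ is empty, its extent in K is the whole of G, hence H = G; otherwise
-- every m ∈ H′ is incident to all of H, i.e. m′ = H in S.  The statement about N is the
-- same argument applied to the transposed contexts.
module Submission where

open import Defs
open import Data.Bool using (true)
open import Data.Bool.Properties using (_≟_)
open import Data.Nat using (ℕ)
open import Data.Fin using (Fin)
open import Data.Fin.Properties using (all?)
open import Data.Fin.Subset using (Subset; _∈_; ⊤; ⁅_⁆; Empty)
open import Data.Fin.Subset.Properties using (_∈?_; ∈⊤; ⊆⊤; ⊆-antisym; x∈⁅y⁆⇒x≡y; nonempty?)
open import Data.Product using (_×_; ∃; _,_; proj₁; proj₂; swap)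
open import Data.Sum using (_⊎_; inj₁; inj₂)
open import Data.Vec using (tabulate)
open import Data.Vec.Properties using (lookup∘tabulate; []=⇒lookup; lookup⇒[]=)
open import Function using (_∘_; flip)
open import Function.Bundles using (_⇔_; mk⇔; module Equivalence)
open import Relation.Nullary using (yes; no; does; contradiction)
open import Relation.Nullary.Decidable using (_×-dec_; _→-dec_; dec-true)
open import Relation.Unary using (Pred; Decidable)
open import Relation.Binary.PropositionalEquality using (_≡_; sym; trans; subst)
open import Level using (0ℓ)

private
  variable
    n k : ℕ

fromDec : {P : Pred (Fin n) 0ℓ} → Decidable P → Subset n
fromDec P? = tabulate (does ∘ P?)

module _ {P : Pred (Fin n) 0ℓ} (P? : Decidable P) {x : Fin n} where

  ∈-fromDec⁺ : P x → x ∈ fromDec P?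
  ∈-fromDec⁺ p = lookup⇒[]= x (fromDec P?) (trans (lookup∘tabulate (does ∘ P?) x) (dec-true (P? x) p))

  ∈-fromDec⁻ : x ∈ fromDec P? → P x
  ∈-fromDec⁻ x∈ with P? x | trans (sym (lookup∘tabulate (does ∘ P?) x)) ([]=⇒lookup x∈)
  ... | yes p | _ = p
  ... | no _  | ()

  ∈-fromDec⇔ : x ∈ fromDec P? ⇔ P x
  ∈-fromDec⇔ = mk⇔ ∈-fromDec⁻ ∈-fromDec⁺

AttrDer? : (R : Incidence n k) (N : Subset k) (A : Subset n) → Decidable (AttrDer R N A)
AttrDer? R N A m = (m ∈? N) ×-dec all? (λ g → (g ∈? A) →-dec (R g m ≟ true))

intent : Incidence n k → Subset k → Subset n → Subset k
intent R N A = fromDec (AttrDer? R N A)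

IsConcept-objects : (R : Incidence n k) (H : Subset n) (N : Subset k) →
                    IsConcept H N R H (intent R N H)
IsConcept-objects R H N = (λ m → ∈-fromDec⇔ (AttrDer? R N H))
                        , (λ g → mk⇔ (λ g∈H → g∈H , λ m m∈B → proj₂ (∈-fromDec⁻ (AttrDer? R N H) m∈B) g g∈H)
                                     proj₁)

IsConcept-emptyIntent⇒extent≡⊤ : {I : Incidence n k} {A : Subset n} {B : Subset k} →
                                 IsConcept ⊤ ⊤ I A B → Empty B → A ≡ ⊤
IsConcept-emptyIntent⇒extent≡⊤ (_ , extent) B-empty =
  ⊆-antisym ⊆⊤ (λ {g} _ → Equivalence.from (extent g) (∈⊤ , λ m m∈B → contradiction (m , m∈B) B-empty))

common⇒ObjDer-⁅⁆⇔ : {R : Incidence n k} {H : Subset n} {m : Fin k} →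
                    (∀ g → g ∈ H → R g m ≡ true) → ∀ g → g ∈ H ⇔ ObjDer R H ⁅ m ⁆ g
common⇒ObjDer-⁅⁆⇔ {R = R} {m = m} common g =
  mk⇔ (λ g∈H → g∈H , λ m′ m′∈⁅m⁆ → subst (λ m′ → R g m′ ≡ true) (sym (x∈⁅y⁆⇒x≡y m m′∈⁅m⁆)) (common g g∈H))
      proj₁

PreservesConcepts : Incidence n k → Subset n → Subset k → Incidence n k → Set
PreservesConcepts I H N J = ∀ A B → IsConcept H N J A B → IsConcept ⊤ ⊤ I A B

PreservesConcepts-transpose : {I J : Incidence n k} {H : Subset n} {N : Subset k} →
                              PreservesConcepts I H N J → PreservesConcepts (flip I) N H (flip J)
PreservesConcepts-transpose preserves B A = swap ∘ preserves A B ∘ swap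

objects≡⊤⊎commonAttribute : {I J : Incidence n k} {H : Subset n} {N : Subset k} →
  PreservesConcepts I H N J →
  H ≡ ⊤ ⊎ ∃ (λ (m : Fin k) → m ∈ N × (∀ g → (g ∈ H ⇔ ObjDer J H ⁅ m ⁆ g)))
objects≡⊤⊎commonAttribute {J = J} {H} {N} preserves with nonempty? (intent J N H)
... | yes (m , m∈B) = let m∈N , common = ∈-fromDec⁻ (AttrDer? J N H) m∈B in
                      inj₂ (m , m∈N , common⇒ObjDer-⁅⁆⇔ common)
... | no B-empty    = inj₁ (IsConcept-emptyIntent⇒extent≡⊤ (preserves H _ (IsConcept-objects J H N)) B-empty)

lemma1 : ∀ {n k} (I : Incidence n k) (H : Subset n) (N : Subset k) (J : Incidence n k) →
    IsClosedSubcontext I H N J →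
    (H ≡ ⊤ ⊎ ∃ (λ (m : Fin k) → m ∈ N × (∀ g → (g ∈ H ⇔ ObjDer J H ⁅ m ⁆ g)))) ×
    (N ≡ ⊤ ⊎ ∃ (λ (g : Fin n) → g ∈ H × (∀ m → (m ∈ N ⇔ AttrDer J N ⁅ g ⁆ m))))
lemma1 I H N J (_ , preserves) =
  objects≡⊤⊎commonAttribute preserves , objects≡⊤⊎commonAttribute (PreservesConcepts-transpose preserves)
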